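{- Let $d\geq 1$ and $k_0\geq 1$ be integers and let $q$ be a prime power with $q>dk_0$. For $i\ge 1$ let $k_i=\lceil q^{2^i}/d\rceil-1$. Then (after suitable row and column permutations as described in the context) $(\mathbf{C}_{q^{2^i},k_i,d})_{i\geq 0}$ is an embedding family of CFFs. Moreover, writing $n_i=q^{2^i(k_i+1)}$ for the number of columns and $t_i$ for the number of rows of the $i$-th matrix, its compression ratio is $\rho(n)=\frac{n}{\log n}$, i.e. $n_i/t_i$ is $O(n_i/\log n_i)$.
   Context: A $d$-CFF$(t,n)$ is a set system with $t$ points and $n$ blocks in which no block is contained in the union of any $d$ other blocks, represented by its $t\times n$ binary incidence matrix. For a prime power $r$ with $\mathbb{F}_r=\{x_1,\dots,x_r\}$ in a fixed order and positive integers $\kappa,\delta$ with $r\ge\delta\kappa+1$, $C_{r,\kappa,\delta}$ is the $(\delta\kappa+1)r\times r^{\kappa+1}$ binary matrix with rows indexed by $(x_j,y)$, $1\le j\le\delta\kappa+1$, $y\in\mathbb{F}_r$, columns indexed by polynomials $f$ over $\mathbb{F}_r$ of degree at most $\kappa$, entry $1$ iff $f(x_j)=y$; it is a $\delta$-CFF. The fields $\mathbb{F}_{q^{2^i}}\subseteq \mathbb{F}_{q^{2^{i+1}}}$ are nested with compatible orderings (elements of the subfield listed first), and $\mathbf{C}_{q^{2^{i}},k_i,d}$ denotes $C_{q^{2^{i}},k_i,d}$ with rows and columns permuted so that the rows $(x_j,y)$ with $j\le dk_{i-1}+1$, $y\in\mathbb{F}_{q^{2^{i-1}}}$ and the columns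 indexed by polynomials of degree at most $k_{i-1}$ over $\mathbb{F}_{q^{2^{i-1}}}$ come first. An embedding family is a sequence $(\mathcal{M}^{(l)})_l$ of incidence matrices of set systems $(X_l,\mathcal{B}_l)$, $\mathcal{M}^{(l)}$ a $d(l)$-CFF, with $X_l\subseteq X_{l+1}$, nondecreasing numbers of rows and columns, $d(l)\le d(l+1)$, and $\mathcal{M}^{(l)}$ equal to the upper-left submatrix of $\mathcal{M}^{(l+1)}$ of its size. -}

module Defs where

open import Level using (0ℓ)
open import Data.Nat using (ℕ; zero; suc; _+_; _*_; _∸_; _^_; _≤_; _<_; _/_)
open import Data.Nat.Primality using (Prime)
open import Data.Fin using (Fin; toℕ; inject≤)
open import Data.Vec using (Vec; []; _∷_; lookup)
open import Data.Bool using (Bool)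
open import Data.Product using (Σ; ∃; _×_; _,_)
open import Relation.Binary.PropositionalEquality using (_≡_; _≢_)
open import Relation.Nullary using (Dec; does; ¬_)
open import Algebra.Structures using (IsCommutativeRing)
open import Function.Bundles using (_↔_; Inverse)

IsPrimePower : ℕ → Set
IsPrimePower q = Σ ℕ λ p → Σ ℕ λ m → Prime p × 1 ≤ m × q ≡ p ^ m

-- ceiling division; ⌈a / d⌉ for d ≥ 1 (junk value 0 for d = 0)
ceilDiv : ℕ → ℕ → ℕ
ceilDiv a zero    = 0
ceilDiv a (suc d) = (a + d) / suc d

record FiniteField (r : ℕ) : Set₁ where
  field
    Carrier : Set
    _⊕_ _⊗_ : Carrier → Carrier → Carrier
    ⊖_      : Carrier → Carrier
    0# 1#   : Carrier
    isCommutativeRing : IsCommutativeRing _≡_ _⊕_ _⊗_ ⊖_ 0# 1#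
    0≢1     : 0# ≢ 1#
    inverse : ∀ a → a ≢ 0# → Σ Carrier λ b → a ⊗ b ≡ 1#
    _≟_     : (a b : Carrier) → Dec (a ≡ b)
    enum    : Fin r ↔ Carrier   -- the fixed order: x_{j+1} = enum j

  x : Fin r → Carrier
  x = Inverse.to enum

open FiniteField public using (Carrier; x)

eval : ∀ {r n} (F : FiniteField r) → Vec (Carrier F) n → Carrier F → Carrier F
eval F []       z = FiniteField.0# F
eval F (a ∷ as) z = FiniteField._⊕_ F a (FiniteField._⊗_ F z (eval F as z))

Matrix : ℕ → ℕ → Set
Matrix t n = Fin t → Fin n → Bool

IsCFF : ∀ {t n} → ℕ → Matrix t n → Set
IsCFF {t} {n} d M =
  (j : Fin n) (cs : Vec (Fin n) d) → (∀ s → lookup cs s ≢ j) →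
  Σ (Fin t) λ r → M r j ≡ Bool.true × (∀ s → M r (lookup cs s) ≡ Bool.false)

EmbeddingFamily : (t n dd : ℕ → ℕ) → ((l : ℕ) → Matrix (t l) (n l)) → Set
EmbeddingFamily t n dd M =
  Σ (∀ l → t l ≤ t (suc l)) λ tm →
  Σ (∀ l → n l ≤ n (suc l)) λ nm →
  (∀ l → dd l ≤ dd (suc l)) ×
  (∀ l → IsCFF (dd l) (M l)) ×
  (∀ l (r : Fin (t l)) (c : Fin (n l)) →
     M l r c ≡ M (suc l) (inject≤ r (tm l)) (inject≤ c (nm l)))

-- Row index set of C_{r,κ,δ}: pairs (x_j, y) with j among the first δκ+1
-- positions of the fixed order (0-based j < δκ+1), y ∈ F_r.
CRow : ∀ {r} → FiniteField r → (κ δ : ℕ) → Set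
CRow {r} F κ δ = Σ (Fin r) (λ j → toℕ j < δ * κ + 1) × Carrier F

CCol : ∀ {r} → FiniteField r → (κ : ℕ) → Set
CCol F κ = Vec (Carrier F) (suc κ)

Centry : ∀ {r} (F : FiniteField r) (κ δ : ℕ) → CRow F κ δ → CCol F κ → Bool
Centry F κ δ ((j , _) , y) f = does (FiniteField._≟_ F (eval F f (x F j)) y)

Cperm : ∀ {r} (F : FiniteField r) (κ δ t n : ℕ) →
        (Fin t ↔ CRow F κ δ) → (Fin n ↔ CCol F κ) → Matrix t n
Cperm F κ δ t n σ τ a b = Centry F κ δ (Inverse.to σ a) (Inverse.to τ b)

-- A tower of nested finite fields F_{q^{2^i}} ⊆ F_{q^{2^{i+1}}} with
-- compatible orderings (elements of the subfield listed first).
record FieldTower (q : ℕ) : Set₁ where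
  field
    F : (i : ℕ) → FiniteField (q ^ (2 ^ i))
    ι : (i : ℕ) → Carrier (F i) → Carrier (F (suc i))
    ι-+ : ∀ i a b → ι i (FiniteField._⊕_ (F i) a b)
                    ≡ FiniteField._⊕_ (F (suc i)) (ι i a) (ι i b)
    ι-* : ∀ i a b → ι i (FiniteField._⊗_ (F i) a b)
                    ≡ FiniteField._⊗_ (F (suc i)) (ι i a) (ι i b)
    ι-0 : ∀ i → ι i (FiniteField.0# (F i)) ≡ FiniteField.0# (F (suc i))
    ι-1 : ∀ i → ι i (FiniteField.1# (F i)) ≡ FiniteField.1# (F (suc i))
    compatible : ∀ i (j : Fin (q ^ (2 ^ i))) (j′ : Fin (q ^ (2 ^ suc i))) →
                 toℕ j ≡ toℕ j′ → x (F (suc i)) j′ ≡ ι i (x (F i) j)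

kSeq : (d q k0 : ℕ) → ℕ → ℕ
kSeq d q k0 zero    = k0
kSeq d q k0 (suc i) = ceilDiv (q ^ (2 ^ suc i)) d ∸ 1

tSeq nSeq : (d q k0 : ℕ) → ℕ → ℕ
tSeq d q k0 i = (d * kSeq d q k0 i + 1) * q ^ (2 ^ i)
nSeq d q k0 i = q ^ (2 ^ i * suc (kSeq d q k0 i))

-- Two distinct polynomials of degree at most κ agree in at most κ points. So for a
-- column f and d other columns g₁ … g_d of C_{r,κ,d}, some x_j among the first dκ + 1
-- field elements has f(x_j) ≠ g_s(x_j) for all s, and the row (x_j, f(x_j)) separates
-- f from them: every level is a d-CFF as soon as dκ < r. The choice
-- k_i = ⌈q^{2^i}/d⌉ - 1 is the largest κ with dκ < q^{2^i}, hence k_i ≤ k_{i+1}.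
-- The subfield inclusion ι sends the row (x_j, y) to (x_j, ι y) and a polynomial to
-- itself, padded with zero coefficients; by the compatibility of the orderings these
-- maps preserve entries, and the enumerations of rows and columns are chosen level by
-- level to extend the previous ones (an injection into a set of the right size
-- extends to a bijection by transpositions). Finally
-- ⌊log₂ n_i⌋ ≤ q 2^i (k_i + 1) ≤ q t_i, because q < 2^q and 2^i ≤ q^{2^i}.

module Submission where

open import Level using (0ℓ)
open import Function using (_∘_; id)
open import Function.Bundles using (_↔_; Inverse; mk↔ₛ′; Injection)
open import Function.Definitions using (Injective)
open import Function.Construct.Composition using (_↔-∘_)
open import Function.Properties.Inverse using (↔⇒↣)
open import Data.Nat
  using (ℕ; zero; suc; _+_; _*_; _∸_; _^_; _/_; _≤_; _<_; z≤n; s≤s; z<s; NonZero; >-nonZero)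
open import Data.Nat.Properties
  using ( +-suc; +-comm; +-identityʳ; *-comm; *-identityʳ; m+n∸n≡m
        ; ≤-refl; ≤-reflexive; ≤-trans; <-trans; ≤-<-trans; <-≤-trans; <⇒≤
        ; <-irrelevant; ≮⇒≥
        ; m≤m+n; m≤n+m; m<m+n; +-cancelˡ-<; +-mono-≤; +-monoˡ-≤; *-mono-≤; *-monoʳ-≤
        ; m^n>0; ^-monoˡ-≤; ^-monoʳ-≤; ^-*-assoc; module ≤-Reasoning)
open import Data.Nat.DivMod using (m/n≡1+[m∸n]/n; m/n*n≤m; m*n/n≡m; /-monoˡ-≤)
open import Data.Nat.Logarithm using (⌊log₂_⌋; ⌊log₂⌋-mono-≤; ⌊log₂[2^n]⌋≡n)
open import Data.Fin as Fin using (Fin; toℕ; inject≤; fromℕ<)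
open import Data.Fin.Properties
  using (toℕ-injective; toℕ-inject≤; toℕ-fromℕ<; toℕ<n; inject≤-injective; *↔×)
  renaming (suc-injective to Fin-suc-injective; _≟_ to _≟ᶠ_)
open import Data.Fin.Permutation using (transpose)
import Data.Fin.Permutation.Components as Transposition
open import Data.Vec using (Vec; []; _∷_; lookup; replicate; map; padRight; truncate)
open import Data.Vec.Properties using (∷-injective; truncate-padRight)
open import Data.List using ([]; _∷_; length; filter)
open import Data.List.Properties using (length-map; length-tabulate)
open import Data.List.Relation.Unary.All as All using (All; []; _∷_)
open import Data.List.Relation.Unary.All.Properties using (all-filter; map⁺)
open import Data.List.Relation.Unary.Any using (here)
open import Data.List.Relation.Unary.Unique.Propositional using (Unique; []; _∷_)
open import Data.List.Relation.Unary.Unique.Propositional.Properties as Unique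
  using (allFin⁺)
open import Data.List.Membership.Propositional using (_∈_)
open import Data.List.Membership.Propositional.Properties using (∈-filter⁻)
open import Data.Product using (Σ; ∃; _×_; _,_; proj₁; proj₂)
open import Data.Product.Function.NonDependent.Propositional using (_×-↔_)
open import Data.Bool using (true; false)
open import Relation.Nullary using (¬_; yes; no; does; contradiction)
open import Relation.Nullary.Decidable using (dec-true; dec-false)
open import Relation.Unary using (Pred; Decidable)
open import Relation.Unary.Properties using (∁?)
open import Relation.Binary.Definitions using (DecidableEquality)
open import Relation.Binary.PropositionalEquality
open import Algebra.Bundles using (CommutativeRing)

open import Defs

-- Finite combinatorics

↔-injective : ∀ {A B : Set} (e : A ↔ B) → Injective _≡_ _≡_ (Inverse.to e)
↔-injective e = Injection.injective (↔⇒↣ e)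

does-≟-injective : ∀ {A B : Set} (_≟ᴬ_ : DecidableEquality A) (_≟ᴮ_ : DecidableEquality B)
                   {h : A → B} → Injective _≡_ _≡_ h →
                   ∀ u v → does (h u ≟ᴮ h v) ≡ does (u ≟ᴬ v)
does-≟-injective _≟ᴬ_ _≟ᴮ_ {h} h-inj u v with u ≟ᴬ v
... | yes refl = dec-true (h u ≟ᴮ h u) refl
... | no u≢v   = dec-false (h u ≟ᴮ h v) (u≢v ∘ h-inj)

length-filter-∁ : ∀ {A : Set} {P : Pred A 0ℓ} (P? : Decidable P) xs →
                  length (filter P? xs) + length (filter (∁? P?) xs) ≡ length xs
length-filter-∁ P? []       = refl
length-filter-∁ P? (x ∷ xs) with does (P? x)
... | true  = cong suc (length-filter-∁ P? xs)
... | false = trans (+-suc _ _) (cong suc (length-filter-∁ P? xs))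

avoid-small-sets : ∀ {A : Set} {d k} (Bad : Fin d → Pred A 0ℓ) →
                   (∀ s → Decidable (Bad s)) →
                   (∀ s {ys} → Unique ys → All (Bad s) ys → length ys ≤ k) →
                   ∀ {xs} → Unique xs → d * k < length xs →
                   ∃ λ a → a ∈ xs × ∀ s → ¬ Bad s a
avoid-small-sets {d = zero} _ _ _ {a ∷ _} _ _ = a , here refl , λ ()
avoid-small-sets {d = suc d} {k} Bad Bad? small {xs} xs! dk<|xs|
  = a , a∈xs , λ { Fin.zero → ¬bad₀ ; (Fin.suc s) → avoids-rest s }
  where
    ¬Bad₀? = ∁? (Bad? Fin.zero)
    xs′ = filter ¬Bad₀? xs
    dk<|xs′| : d * k < length xs′
    dk<|xs′| = +-cancelˡ-< k (d * k) (length xs′) (begin-strict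
      k + d * k                                        <⟨ dk<|xs| ⟩
      length xs                                        ≡⟨ length-filter-∁ (Bad? Fin.zero) xs ⟨
      length (filter (Bad? Fin.zero) xs) + length xs′  ≤⟨ +-monoˡ-≤ _ (small Fin.zero
                                                            (Unique.filter⁺ (Bad? Fin.zero) xs!)
                                                            (all-filter (Bad? Fin.zero) xs)) ⟩
      k + length xs′                                   ∎)
      where open ≤-Reasoning
    rest = avoid-small-sets (Bad ∘ Fin.suc) (Bad? ∘ Fin.suc) (small ∘ Fin.suc)
                            (Unique.filter⁺ ¬Bad₀? xs!) dk<|xs′|
    a = proj₁ rest
    avoids-rest = proj₂ (proj₂ rest)
    a∈xs×¬bad₀ = ∈-filter⁻ ¬Bad₀? {xs = xs} (proj₁ (proj₂ rest))
    a∈xs = proj₁ a∈xs×¬bad₀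
    ¬bad₀ = proj₂ a∈xs×¬bad₀

transpose-source : ∀ {n} (i j : Fin n) → Transposition.transpose i j i ≡ j
transpose-source i j rewrite dec-true (i ≟ᶠ i) refl = refl

transpose-fixes : ∀ {n} {i j k : Fin n} → k ≢ i → k ≢ j → Transposition.transpose i j k ≡ k
transpose-fixes {i = i} {j} {k} k≢i k≢j
  rewrite dec-false (k ≟ᶠ i) k≢i | dec-false (k ≟ᶠ j) k≢j = refl

extend-injection : ∀ {B : Set} {m n} → Fin n ↔ B →
                   (pos : Fin m → Fin n) → Injective _≡_ _≡_ pos →
                   (g : Fin m → B) → Injective _≡_ _≡_ g →
                   Σ (Fin n ↔ B) λ π → ∀ a → Inverse.to π (pos a) ≡ g a
extend-injection {m = zero}  β _ _ _ _ = β , λ ()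
extend-injection {m = suc m} β pos pos-inj g g-inj = π , π-extends
  where
    -- π′ already places g (suc a) at pos (suc a); composing with the transposition
    -- of pos 0 and π′⁻¹ (g 0) places g 0 without moving the other points.
    rest = extend-injection β (pos ∘ Fin.suc) (Fin-suc-injective ∘ pos-inj)
                              (g ∘ Fin.suc) (Fin-suc-injective ∘ g-inj)
    π′ = proj₁ rest
    target = Inverse.from π′ (g Fin.zero)
    π = π′ ↔-∘ transpose (pos Fin.zero) target

    π-extends : ∀ a → Inverse.to π (pos a) ≡ g a
    π-extends Fin.zero = begin
      Inverse.to π′ (Transposition.transpose (pos Fin.zero) target (pos Fin.zero))
        ≡⟨ cong (Inverse.to π′) (transpose-source (pos Fin.zero) target) ⟩
      Inverse.to π′ target
        ≡⟨ Inverse.strictlyInverseˡ π′ (g Fin.zero) ⟩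
      g Fin.zero ∎
      where open ≡-Reasoning
    π-extends (Fin.suc a) =
      trans (cong (Inverse.to π′) (transpose-fixes ≢pos₀ ≢target)) (proj₂ rest a)
      where
        ≢pos₀ : pos (Fin.suc a) ≢ pos Fin.zero
        ≢pos₀ eq with pos-inj eq
        ... | ()
        ≢target : pos (Fin.suc a) ≢ target
        ≢target eq with g-inj (trans (sym (proj₂ rest a)) (trans (cong (Inverse.to π′) eq)
                                 (Inverse.strictlyInverseˡ π′ (g Fin.zero))))
        ... | ()

module CoherentEnumerations {size : ℕ → ℕ} {A : ℕ → Set}
         (size-mono : ∀ i → size i ≤ size (suc i)) (β : ∀ i → Fin (size i) ↔ A i)
         (e : ∀ i → A i → A (suc i)) (e-injective : ∀ i → Injective _≡_ _≡_ (e i)) where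

  private
    extension : ∀ i (σᵢ : Fin (size i) ↔ A i) →
                Σ (Fin (size (suc i)) ↔ A (suc i)) λ π →
                  ∀ a → Inverse.to π (inject≤ a (size-mono i)) ≡ e i (Inverse.to σᵢ a)
    extension i σᵢ = extend-injection (β (suc i)) (λ a → inject≤ a (size-mono i))
                       (inject≤-injective _ _ _ _)
                       (e i ∘ Inverse.to σᵢ) (↔-injective σᵢ ∘ e-injective i)

  σ : ∀ i → Fin (size i) ↔ A i
  σ zero    = β zero
  σ (suc i) = proj₁ (extension i (σ i))

  σ-coherent : ∀ i a →
               Inverse.to (σ (suc i)) (inject≤ a (size-mono i)) ≡ e i (Inverse.to (σ i) a)
  σ-coherent i = proj₂ (extension i (σ i))

<⇒+1≤ : ∀ {m n} → m < n → m + 1 ≤ n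
<⇒+1≤ {m} {n} = subst (_≤ n) (+-comm 1 m)

map-injective : ∀ {A B : Set} {h : A → B} → Injective _≡_ _≡_ h →
                ∀ {n} → Injective _≡_ _≡_ (map {n = n} h)
map-injective h-inj {x = []}    {[]}    _  = refl
map-injective h-inj {x = a ∷ u} {b ∷ v} eq =
  cong₂ _∷_ (h-inj (proj₁ (∷-injective eq))) (map-injective h-inj (proj₂ (∷-injective eq)))

Prefix : ℕ → ℕ → Set
Prefix r m = Σ (Fin r) λ j → toℕ j < m

Prefix-≡ : ∀ {r m} {j j′ : Fin r} {p : toℕ j < m} {p′ : toℕ j′ < m} →
           j ≡ j′ → _≡_ {A = Prefix r m} (j , p) (j′ , p′)
Prefix-≡ {p = p} {p′} refl = cong (_ ,_) (<-irrelevant p p′)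

prefix↔ : ∀ {m r} → m ≤ r → Fin m ↔ Prefix r m
prefix↔ {m} m≤r = mk↔ₛ′ to from to∘from from∘to
  where
    to : Fin m → Prefix _ m
    to a = inject≤ a m≤r , subst (_< m) (sym (toℕ-inject≤ a m≤r)) (toℕ<n a)
    from : Prefix _ m → Fin m
    from (j , j<m) = fromℕ< j<m
    to∘from : ∀ b → to (from b) ≡ b
    to∘from (j , j<m) =
      Prefix-≡ (toℕ-injective (trans (toℕ-inject≤ _ m≤r) (toℕ-fromℕ< j<m)))
    from∘to : ∀ a → from (to a) ≡ a
    from∘to a = toℕ-injective (trans (toℕ-fromℕ< _) (toℕ-inject≤ a m≤r))

^↔Vec : ∀ {A : Set} {r} → Fin r ↔ A → ∀ n → Fin (r ^ n) ↔ Vec A n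
^↔Vec e zero    = mk↔ₛ′ (λ _ → []) (λ _ → Fin.zero)
                         (λ { [] → refl }) (λ { Fin.zero → refl ; (Fin.suc ()) })
^↔Vec {A} e (suc n) = ∷↔ ↔-∘ ((e ×-↔ ^↔Vec e n) ↔-∘ *↔×)
  where
    ∷↔ : (A × Vec A n) ↔ Vec A (suc n)
    ∷↔ = mk↔ₛ′ (λ p → proj₁ p ∷ proj₂ p) (λ { (a ∷ v) → a , v })
               (λ { (a ∷ v) → refl }) (λ _ → refl)

-- Finite fields and polynomials

module FieldArithmetic {r : ℕ} (F : FiniteField r) where

  open FiniteField F using (inverse; isCommutativeRing)

  ring : CommutativeRing 0ℓ 0ℓ
  ring = record { isCommutativeRing = isCommutativeRing }

  module R = CommutativeRing ring
  open R public using (_-_; 0#; 1#) renaming (_+_ to infixl 6 _⊕_; _*_ to infixl 7 _⊗_)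
  open import Algebra.Properties.Group R.+-group public using (∙-cancelʳ; x∙y⁻¹≈ε⇒x≈y)
  open ≡-Reasoning

  ⊗-cancelˡ : ∀ {a} b c → a ≢ 0# → a ⊗ b ≡ a ⊗ c → b ≡ c
  ⊗-cancelˡ {a} b c a≢0 ab≡ac = begin
    b              ≡⟨ R.*-identityˡ b ⟨
    1# ⊗ b         ≡⟨ cong (_⊗ b) a⁻¹a≡1 ⟨
    (a⁻¹ ⊗ a) ⊗ b  ≡⟨ R.*-assoc a⁻¹ a b ⟩
    a⁻¹ ⊗ (a ⊗ b)  ≡⟨ cong (a⁻¹ ⊗_) ab≡ac ⟩
    a⁻¹ ⊗ (a ⊗ c)  ≡⟨ R.*-assoc a⁻¹ a c ⟨
    (a⁻¹ ⊗ a) ⊗ c  ≡⟨ cong (_⊗ c) a⁻¹a≡1 ⟩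
    1# ⊗ c         ≡⟨ R.*-identityˡ c ⟩
    c              ∎
    where
      a⁻¹ = proj₁ (inverse a a≢0)
      a⁻¹a≡1 : a⁻¹ ⊗ a ≡ 1#
      a⁻¹a≡1 = trans (R.*-comm a⁻¹ a) (proj₂ (inverse a a≢0))

  x-y⊕y≡x : ∀ z a → (z - a) ⊕ a ≡ z
  x-y⊕y≡x z a =
    trans (R.+-assoc z (R.- a) a) (trans (cong (z ⊕_) (R.-‿inverseˡ a)) (R.+-identityʳ z))

  x⊕y⊗0#≡x : ∀ u z → u ⊕ z ⊗ 0# ≡ u
  x⊕y⊗0#≡x u z = trans (cong (u ⊕_) (R.zeroʳ z)) (R.+-identityʳ u)

module Polynomial {r : ℕ} (F : FiniteField r) where

  open FieldArithmetic F
  open import Algebra.Solver.Ring.NaturalCoefficients.Default R.commutativeSemiring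
    using (solve; _:+_; _:*_; _:=_)
  open ≡-Reasoning

  ⟦_⟧ : ∀ {n} → Vec (Carrier F) n → Carrier F → Carrier F
  ⟦_⟧ = eval F

  eval-replicate-0# : ∀ n z → ⟦ replicate n 0# ⟧ z ≡ 0#
  eval-replicate-0# zero    z = refl
  eval-replicate-0# (suc n) z =
    trans (cong (λ u → 0# ⊕ z ⊗ u) (eval-replicate-0# n z)) (x⊕y⊗0#≡x 0# z)

  eval-padRight : ∀ {m n} (m≤n : m ≤ n) (f : Vec (Carrier F) m) z →
                  ⟦ padRight m≤n 0# f ⟧ z ≡ ⟦ f ⟧ z
  eval-padRight {n = n} z≤n [] z = eval-replicate-0# n z
  eval-padRight (s≤s m≤n) (a ∷ f) z = cong (λ u → a ⊕ z ⊗ u) (eval-padRight m≤n f z)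

  -- Synthetic division by z - a: the coefficients of the quotient are the
  -- values at a of the tails of the dividend.
  quotient : ∀ {k} → Carrier F → Vec (Carrier F) (suc k) → Vec (Carrier F) k
  quotient a (h₀ ∷ [])     = []
  quotient a (h₀ ∷ h₁ ∷ h) = ⟦ h₁ ∷ h ⟧ a ∷ quotient a (h₁ ∷ h)

  -- Stated with w for z - a, so that it is a semiring identity within reach of the
  -- natural-coefficient solver.
  horner-step : ∀ h₀ w a q e →
                h₀ ⊕ (w ⊕ a) ⊗ (w ⊗ q ⊕ e) ≡ w ⊗ (e ⊕ (w ⊕ a) ⊗ q) ⊕ (h₀ ⊕ a ⊗ e)
  horner-step = solve 5 (λ h₀ w a q e → h₀ :+ (w :+ a) :* (w :* q :+ e)
                                       := w :* (e :+ (w :+ a) :* q) :+ (h₀ :+ a :* e)) refl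

  division-by-linear : ∀ {k} a (h : Vec (Carrier F) (suc k)) z →
                       ⟦ h ⟧ z ≡ (z - a) ⊗ ⟦ quotient a h ⟧ z ⊕ ⟦ h ⟧ a
  division-by-linear a (h₀ ∷ []) z = begin
    h₀ ⊕ z ⊗ 0#                   ≡⟨ x⊕y⊗0#≡x h₀ z ⟩
    h₀                            ≡⟨ x⊕y⊗0#≡x h₀ a ⟨
    h₀ ⊕ a ⊗ 0#                   ≡⟨ R.+-identityˡ _ ⟨
    0# ⊕ (h₀ ⊕ a ⊗ 0#)            ≡⟨ cong (_⊕ (h₀ ⊕ a ⊗ 0#)) (R.zeroʳ (z - a)) ⟨
    (z - a) ⊗ 0# ⊕ (h₀ ⊕ a ⊗ 0#)  ∎
  division-by-linear a (h₀ ∷ h@(_ ∷ _)) z = begin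
    h₀ ⊕ z ⊗ ⟦ h ⟧ z                      ≡⟨ cong (λ u → h₀ ⊕ z ⊗ u) (division-by-linear a h z) ⟩
    h₀ ⊕ z ⊗ (w ⊗ q ⊕ e)                  ≡⟨ cong (λ u → h₀ ⊕ u ⊗ (w ⊗ q ⊕ e)) w⊕a≡z ⟨
    h₀ ⊕ (w ⊕ a) ⊗ (w ⊗ q ⊕ e)            ≡⟨ horner-step h₀ w a q e ⟩
    w ⊗ (e ⊕ (w ⊕ a) ⊗ q) ⊕ (h₀ ⊕ a ⊗ e)  ≡⟨ cong (λ u → w ⊗ (e ⊕ u ⊗ q) ⊕ (h₀ ⊕ a ⊗ e)) w⊕a≡z ⟩
    w ⊗ (e ⊕ z ⊗ q) ⊕ (h₀ ⊕ a ⊗ e)        ∎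
    where
      w = z - a
      e = ⟦ h ⟧ a
      q = ⟦ quotient a h ⟧ z
      w⊕a≡z = x-y⊕y≡x z a

  quotient-injective : ∀ {k} a (f g : Vec (Carrier F) (suc k)) →
                       quotient a f ≡ quotient a g → ⟦ f ⟧ a ≡ ⟦ g ⟧ a → f ≡ g
  quotient-injective a (f₀ ∷ []) (g₀ ∷ []) _ fa≡ga =
    cong (_∷ []) (∙-cancelʳ (a ⊗ 0#) f₀ g₀ fa≡ga)
  quotient-injective a (f₀ ∷ f@(_ ∷ _)) (g₀ ∷ g@(_ ∷ _)) qf≡qg f₀∷f≡g₀∷g-at-a =
    cong₂ _∷_ (∙-cancelʳ (a ⊗ ⟦ g ⟧ a) f₀ g₀ heads-at-a) (quotient-injective a f g qf≡qg′ fa≡ga)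
    where
      fa≡ga = proj₁ (∷-injective qf≡qg)
      qf≡qg′ = proj₂ (∷-injective qf≡qg)
      heads-at-a : f₀ ⊕ a ⊗ ⟦ g ⟧ a ≡ g₀ ⊕ a ⊗ ⟦ g ⟧ a
      heads-at-a = subst (λ u → f₀ ⊕ a ⊗ u ≡ g₀ ⊕ a ⊗ ⟦ g ⟧ a) fa≡ga f₀∷f≡g₀∷g-at-a

  quotient-agrees : ∀ {k} {a p} (f g : Vec (Carrier F) (suc k)) → a ≢ p →
                    ⟦ f ⟧ a ≡ ⟦ g ⟧ a → ⟦ f ⟧ p ≡ ⟦ g ⟧ p →
                    ⟦ quotient a f ⟧ p ≡ ⟦ quotient a g ⟧ p
  quotient-agrees {a = a} {p} f g a≢p fa≡ga fp≡gp =
    ⊗-cancelˡ _ _ p-a≢0 (∙-cancelʳ (⟦ g ⟧ a) _ _ (begin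
      (p - a) ⊗ ⟦ quotient a f ⟧ p ⊕ ⟦ g ⟧ a  ≡⟨ cong (_ ⊕_) fa≡ga ⟨
      (p - a) ⊗ ⟦ quotient a f ⟧ p ⊕ ⟦ f ⟧ a  ≡⟨ division-by-linear a f p ⟨
      ⟦ f ⟧ p                                  ≡⟨ fp≡gp ⟩
      ⟦ g ⟧ p                                  ≡⟨ division-by-linear a g p ⟩
      (p - a) ⊗ ⟦ quotient a g ⟧ p ⊕ ⟦ g ⟧ a  ∎))
    where
      p-a≢0 : p - a ≢ 0#
      p-a≢0 p-a≡0 = a≢p (sym (x∙y⁻¹≈ε⇒x≈y p a p-a≡0))

  unique-interpolation : ∀ {k} (f g : Vec (Carrier F) (suc k)) {ps} → Unique ps → k < length ps →
                         All (λ p → ⟦ f ⟧ p ≡ ⟦ g ⟧ p) ps → f ≡ g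
  unique-interpolation {zero} f@(_ ∷ []) g@(_ ∷ []) _ _ (fa≡ga ∷ _) =
    quotient-injective _ f g refl fa≡ga
  unique-interpolation {suc k} f g (a≢ps ∷ ps!) (s≤s k<|ps|) (fa≡ga ∷ f≗g-on-ps) =
    quotient-injective _ f g
      (unique-interpolation (quotient _ f) (quotient _ g) ps! k<|ps|
        (All.zipWith (λ (a≢p , fp≡gp) → quotient-agrees f g a≢p fa≡ga fp≡gp)
                     (a≢ps , f≗g-on-ps)))
      fa≡ga

  agreement-bound : ∀ {k} {f g : Vec (Carrier F) (suc k)} → f ≢ g → ∀ {ps} → Unique ps →
                    All (λ p → ⟦ f ⟧ p ≡ ⟦ g ⟧ p) ps → length ps ≤ k
  agreement-bound f≢g ps! f≗g =
    ≮⇒≥ λ k<|ps| → f≢g (unique-interpolation _ _ ps! k<|ps| f≗g)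

-- The matrices C_{r,κ,δ} and the tower embeddings

module _ {r : ℕ} (F : FiniteField r) where

  open Polynomial F using (⟦_⟧; agreement-bound)
  open FiniteField F using (_≟_; enum)

  Cperm-from : ∀ {κ δ t n} (σ : Fin t ↔ CRow F κ δ) (τ : Fin n ↔ CCol F κ) row b →
               Cperm F κ δ t n σ τ (Inverse.from σ row) b ≡ Centry F κ δ row (Inverse.to τ b)
  Cperm-from {κ} {δ} σ τ row b =
    cong (λ ρ → Centry F κ δ ρ (Inverse.to τ b)) (Inverse.strictlyInverseˡ σ row)

  C-isCFF : ∀ {κ δ t n} (σ : Fin t ↔ CRow F κ δ) (τ : Fin n ↔ CCol F κ) →
            δ * κ < r → IsCFF δ (Cperm F κ δ t n σ τ)
  C-isCFF {κ} {δ} {t} {n} σ τ δκ<r j cs cs≢j = Inverse.from σ row , f-hit , g-miss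
    where
      m = δ * κ + 1
      m≤r : m ≤ r
      m≤r = <⇒+1≤ δκ<r
      point : Fin m → Carrier F
      point a = x F (inject≤ a m≤r)
      point-injective : Injective _≡_ _≡_ point
      point-injective = inject≤-injective _ _ _ _ ∘ ↔-injective enum
      f = Inverse.to τ j
      g : Fin δ → CCol F κ
      g s = Inverse.to τ (lookup cs s)
      f≢g : ∀ s → f ≢ g s
      f≢g s f≡gs = cs≢j s (↔-injective τ (sym f≡gs))
      Agree : Fin δ → Pred (Fin m) 0ℓ
      Agree s a = ⟦ f ⟧ (point a) ≡ ⟦ g s ⟧ (point a)
      few-agreements : ∀ s {ys} → Unique ys → All (Agree s) ys → length ys ≤ κ
      few-agreements s {ys} ys! agree = subst (_≤ κ) (length-map point ys)
        (agreement-bound (f≢g s) (Unique.map⁺ point-injective ys!) (map⁺ agree))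
      good = avoid-small-sets Agree (λ s a → ⟦ f ⟧ (point a) ≟ ⟦ g s ⟧ (point a))
               few-agreements (allFin⁺ m)
               (subst (δ * κ <_) (sym (length-tabulate id)) (m<m+n (δ * κ) z<s))
      a = proj₁ good
      f-avoids-g : ∀ s → ¬ Agree s a
      f-avoids-g = proj₂ (proj₂ good)
      row : CRow F κ δ
      row = Inverse.to (prefix↔ m≤r) a , ⟦ f ⟧ (point a)
      f-hit : Cperm F κ δ t n σ τ (Inverse.from σ row) j ≡ true
      f-hit = trans (Cperm-from {κ} {δ} {t} {n} σ τ row j)
                    (dec-true (⟦ f ⟧ (point a) ≟ ⟦ f ⟧ (point a)) refl)
      g-miss : ∀ s → Cperm F κ δ t n σ τ (Inverse.from σ row) (lookup cs s) ≡ false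
      g-miss s = trans (Cperm-from {κ} {δ} {t} {n} σ τ row (lookup cs s))
                       (dec-false (⟦ g s ⟧ (point a) ≟ ⟦ f ⟧ (point a)) (f-avoids-g s ∘ sym))

  CRow↔ : ∀ {κ δ} → δ * κ < r → Fin ((δ * κ + 1) * r) ↔ CRow F κ δ
  CRow↔ δκ<r = (prefix↔ (<⇒+1≤ δκ<r) ×-↔ enum) ↔-∘ *↔×

  CCol↔ : ∀ κ → Fin (r ^ suc κ) ↔ CCol F κ
  CCol↔ κ = ^↔Vec enum (suc κ)

module TowerStep {q : ℕ} (T : FieldTower q) (i : ℕ) where

  open FieldTower T using (F; ι; ι-+; ι-*; ι-0; ι-1; compatible)
  private
    module K  = FiniteField (F i)
    module L  = FiniteField (F (suc i))
    module AK = FieldArithmetic (F i)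
    module AL = FieldArithmetic (F (suc i))
  open ≡-Reasoning

  ι-injective : Injective _≡_ _≡_ (ι i)
  ι-injective {a} {b} ιa≡ιb with a K.≟ b
  ... | yes a≡b = a≡b
  ... | no a≢b  = contradiction 1≡0 (L.0≢1 ∘ sym)
    where
      c = a AK.- b
      c≢0 : c ≢ AK.0#
      c≢0 = a≢b ∘ AK.x∙y⁻¹≈ε⇒x≈y a b
      c⁻¹ = proj₁ (K.inverse c c≢0)
      ιc≡0 : ι i c ≡ AL.0#
      ιc≡0 = AL.∙-cancelʳ (ι i b) (ι i c) AL.0# (begin
        ι i c AL.⊕ ι i b  ≡⟨ ι-+ i c b ⟨
        ι i (c AK.⊕ b)    ≡⟨ cong (ι i) (AK.x-y⊕y≡x a b) ⟩
        ι i a             ≡⟨ ιa≡ιb ⟩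
        ι i b             ≡⟨ AL.R.+-identityˡ (ι i b) ⟨
        AL.0# AL.⊕ ι i b  ∎)
      1≡0 : AL.1# ≡ AL.0#
      1≡0 = begin
        AL.1#               ≡⟨ ι-1 i ⟨
        ι i AK.1#           ≡⟨ cong (ι i) (proj₂ (K.inverse c c≢0)) ⟨
        ι i (c AK.⊗ c⁻¹)    ≡⟨ ι-* i c c⁻¹ ⟩
        ι i c AL.⊗ ι i c⁻¹  ≡⟨ cong (AL._⊗ ι i c⁻¹) ιc≡0 ⟩
        AL.0# AL.⊗ ι i c⁻¹  ≡⟨ AL.R.zeroˡ (ι i c⁻¹) ⟩
        AL.0#               ∎

  eval-ι : ∀ {n} (f : Vec (Carrier (F i)) n) z →
           eval (F (suc i)) (map (ι i) f) (ι i z) ≡ ι i (eval (F i) f z)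
  eval-ι []      z = sym (ι-0 i)
  eval-ι (a ∷ f) z = begin
    ι i a AL.⊕ ι i z AL.⊗ eval (F (suc i)) (map (ι i) f) (ι i z)
      ≡⟨ cong (λ u → ι i a AL.⊕ ι i z AL.⊗ u) (eval-ι f z) ⟩
    ι i a AL.⊕ ι i z AL.⊗ ι i (eval (F i) f z)
      ≡⟨ cong (ι i a AL.⊕_) (ι-* i z _) ⟨
    ι i a AL.⊕ ι i (z AK.⊗ eval (F i) f z)
      ≡⟨ ι-+ i a _ ⟨
    ι i (a AK.⊕ z AK.⊗ eval (F i) f z)
      ∎

  module Embedding (r≤r′ : q ^ 2 ^ i ≤ q ^ 2 ^ suc i) {δ κ κ′ : ℕ} (κ≤κ′ : κ ≤ κ′) where

    embedRow : CRow (F i) κ δ → CRow (F (suc i)) κ′ δ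
    embedRow ((j , j<m) , y) = (inject≤ j r≤r′ , j<m′) , ι i y
      where
        j<m′ : toℕ (inject≤ j r≤r′) < δ * κ′ + 1
        j<m′ = subst (_< δ * κ′ + 1) (sym (toℕ-inject≤ j r≤r′))
                     (≤-trans j<m (+-monoˡ-≤ 1 (*-monoʳ-≤ δ κ≤κ′)))

    embedRow-injective : Injective _≡_ _≡_ embedRow
    embedRow-injective {(j , _) , _} {(j′ , _) , _} eq =
      cong₂ _,_ (Prefix-≡ (inject≤-injective _ _ j j′ (cong (proj₁ ∘ proj₁) eq)))
                (ι-injective (cong proj₂ eq))

    embedCol : CCol (F i) κ → CCol (F (suc i)) κ′
    embedCol f = padRight (s≤s κ≤κ′) AL.0# (map (ι i) f)

    embedCol-injective : Injective _≡_ _≡_ embedCol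
    embedCol-injective {f} {g} eq = map-injective ι-injective (begin
      map (ι i) f                                ≡⟨ truncate-padRight (s≤s κ≤κ′) AL.0# _ ⟨
      truncate (s≤s κ≤κ′) (embedCol f)           ≡⟨ cong (truncate (s≤s κ≤κ′)) eq ⟩
      truncate (s≤s κ≤κ′) (embedCol g)           ≡⟨ truncate-padRight (s≤s κ≤κ′) AL.0# _ ⟩
      map (ι i) g                                ∎)

    Centry-embed : ∀ row f →
                   Centry (F (suc i)) κ′ δ (embedRow row) (embedCol f) ≡ Centry (F i) κ δ row f
    Centry-embed ((j , _) , y) f = begin
      does (eval (F (suc i)) (embedCol f) (x (F (suc i)) (inject≤ j r≤r′)) L.≟ ι i y)
        ≡⟨ cong (λ u → does (u L.≟ ι i y)) value ⟩
      does (ι i (eval (F i) f (x (F i) j)) L.≟ ι i y)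
        ≡⟨ does-≟-injective K._≟_ L._≟_ ι-injective _ y ⟩
      does (eval (F i) f (x (F i) j) K.≟ y) ∎
      where
        value : eval (F (suc i)) (embedCol f) (x (F (suc i)) (inject≤ j r≤r′))
                ≡ ι i (eval (F i) f (x (F i) j))
        value = begin
          eval (F (suc i)) (embedCol f) (x (F (suc i)) (inject≤ j r≤r′))
            ≡⟨ cong (eval (F (suc i)) (embedCol f))
                    (compatible i j _ (sym (toℕ-inject≤ j r≤r′))) ⟩
          eval (F (suc i)) (embedCol f) (ι i (x (F i) j))
            ≡⟨ Polynomial.eval-padRight (F (suc i)) (s≤s κ≤κ′) (map (ι i) f) _ ⟩
          eval (F (suc i)) (map (ι i) f) (ι i (x (F i) j))
            ≡⟨ eval-ι f _ ⟩
          ι i (eval (F i) f (x (F i) j)) ∎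

-- Arithmetic of the parameters

ceilDiv-suc∸1 : ∀ a d′ → ceilDiv (suc a) (suc d′) ∸ 1 ≡ a / suc d′
ceilDiv-suc∸1 a d′ = begin
  (suc a + d′) / suc d′ ∸ 1            ≡⟨ cong (λ m → m / suc d′ ∸ 1) (+-suc a d′) ⟨
  (a + suc d′) / suc d′ ∸ 1            ≡⟨ cong (_∸ 1) (m/n≡1+[m∸n]/n (m≤n+m (suc d′) a)) ⟩
  (a + suc d′ ∸ suc d′) / suc d′       ≡⟨ cong (_/ suc d′) (m+n∸n≡m a (suc d′)) ⟩
  a / suc d′                           ∎
  where open ≡-Reasoning

*-ceilDiv∸1< : ∀ {a} d′ → 0 < a → suc d′ * (ceilDiv a (suc d′) ∸ 1) < a
*-ceilDiv∸1< {suc a} d′ _ rewrite ceilDiv-suc∸1 a d′ =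
  s≤s (≤-trans (≤-reflexive (*-comm (suc d′) (a / suc d′))) (m/n*n≤m a (suc d′)))

ceilDiv∸1-maximal : ∀ {a} d′ b → suc d′ * b < a → b ≤ ceilDiv a (suc d′) ∸ 1
ceilDiv∸1-maximal {suc a} d′ b (s≤s db≤a) rewrite ceilDiv-suc∸1 a d′ = begin
  b                    ≡⟨ m*n/n≡m b (suc d′) ⟨
  b * suc d′ / suc d′  ≤⟨ /-monoˡ-≤ (suc d′) (subst (_≤ a) (*-comm (suc d′) b) db≤a) ⟩
  a / suc d′           ∎
  where open ≤-Reasoning

n<2^n : ∀ n → n < 2 ^ n
n<2^n zero    = z<s
n<2^n (suc n) = ≤-trans (+-mono-≤ (m^n>0 2 n) (n<2^n n))
                        (≤-reflexive (cong (2 ^ n +_) (sym (+-identityʳ (2 ^ n)))))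

⌊log₂[m^n]⌋≤m*n : ∀ m n → ⌊log₂ (m ^ n) ⌋ ≤ m * n
⌊log₂[m^n]⌋≤m*n m n = begin
  ⌊log₂ (m ^ n) ⌋        ≤⟨ ⌊log₂⌋-mono-≤ (^-monoˡ-≤ n (<⇒≤ (n<2^n m))) ⟩
  ⌊log₂ ((2 ^ m) ^ n) ⌋  ≡⟨ cong ⌊log₂_⌋ (^-*-assoc 2 m n) ⟩
  ⌊log₂ (2 ^ (m * n)) ⌋  ≡⟨ ⌊log₂[2^n]⌋≡n (m * n) ⟩
  m * n                  ∎
  where open ≤-Reasoning

-- The embedding family

module Construction (d′ k0 q : ℕ) (1<q : 1 < q) (dk0<q : suc d′ * k0 < q) (T : FieldTower q) where

  d : ℕ
  d = suc d′

  k t n : ℕ → ℕ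
  k = kSeq d q k0
  t = tSeq d q k0
  n = nSeq d q k0

  open FieldTower T using (F)

  instance
    q-nonZero : NonZero q
    q-nonZero = >-nonZero (<-trans z<s 1<q)

  field-size-mono : ∀ i → q ^ 2 ^ i ≤ q ^ 2 ^ suc i
  field-size-mono i = ^-monoʳ-≤ q (m≤m+n (2 ^ i) _)

  degree-fits : ∀ i → d * k i < q ^ 2 ^ i
  degree-fits zero    = subst (d * k0 <_) (sym (*-identityʳ q)) dk0<q
  degree-fits (suc i) = *-ceilDiv∸1< d′ (m^n>0 q (2 ^ suc i))

  k-mono : ∀ i → k i ≤ k (suc i)
  k-mono i = ceilDiv∸1-maximal d′ (k i) (<-≤-trans (degree-fits i) (field-size-mono i))

  t-mono : ∀ i → t i ≤ t (suc i)
  t-mono i = *-mono-≤ (+-monoˡ-≤ 1 (*-monoʳ-≤ d (k-mono i))) (field-size-mono i)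

  n-mono : ∀ i → n i ≤ n (suc i)
  n-mono i = ^-monoʳ-≤ q (*-mono-≤ (m≤m+n (2 ^ i) _) (s≤s (k-mono i)))

  log-bound : ∀ i → ⌊log₂ n i ⌋ ≤ q * t i
  log-bound i = begin
    ⌊log₂ n i ⌋                      ≤⟨ ⌊log₂[m^n]⌋≤m*n q (2 ^ i * suc (k i)) ⟩
    q * (2 ^ i * suc (k i))          ≤⟨ *-monoʳ-≤ q (*-mono-≤ 2^i≤q^2^i suc-k≤dk+1) ⟩
    q * (q ^ 2 ^ i * (d * k i + 1))  ≡⟨ cong (q *_) (*-comm (q ^ 2 ^ i) (d * k i + 1)) ⟩
    q * t i                          ∎
    where
      open ≤-Reasoning
      2^i≤q^2^i : 2 ^ i ≤ q ^ 2 ^ i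
      2^i≤q^2^i = ≤-trans (<⇒≤ (n<2^n (2 ^ i))) (^-monoˡ-≤ (2 ^ i) 1<q)
      suc-k≤dk+1 : suc (k i) ≤ d * k i + 1
      suc-k≤dk+1 = ≤-trans (s≤s (m≤m+n (k i) (d′ * k i))) (≤-reflexive (+-comm 1 (d * k i)))

  module Step (i : ℕ) = TowerStep.Embedding T i (field-size-mono i) {δ = d} (k-mono i)

  module Rows = CoherentEnumerations {A = λ i → CRow (F i) (k i) d} t-mono
                  (λ i → CRow↔ (F i) {k i} {d} (degree-fits i))
                  Step.embedRow (λ i → Step.embedRow-injective i)
  module Cols = CoherentEnumerations {A = λ i → CCol (F i) (k i)} n-mono
                  (λ i → subst (λ N → Fin N ↔ CCol (F i) (k i)) (^-*-assoc q (2 ^ i) (suc (k i)))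
                               (CCol↔ (F i) (k i)))
                  Step.embedCol (λ i → Step.embedCol-injective i)

  σ : ∀ i → Fin (t i) ↔ CRow (F i) (k i) d
  σ = Rows.σ

  τ : ∀ i → Fin (n i) ↔ CCol (F i) (k i)
  τ = Cols.σ

  C : ∀ i → Matrix (t i) (n i)
  C i = Cperm (F i) (k i) d (t i) (n i) (σ i) (τ i)

  C-embeds : ∀ l r c → C l r c ≡ C (suc l) (inject≤ r (t-mono l)) (inject≤ c (n-mono l))
  C-embeds l r c = sym (begin
    C (suc l) (inject≤ r (t-mono l)) (inject≤ c (n-mono l))
      ≡⟨ cong₂ (Centry (F (suc l)) (k (suc l)) d) (Rows.σ-coherent l r) (Cols.σ-coherent l c) ⟩
    Centry (F (suc l)) (k (suc l)) d (Step.embedRow l (Inverse.to (σ l) r))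
                                     (Step.embedCol l (Inverse.to (τ l) c))
      ≡⟨ Step.Centry-embed l (Inverse.to (σ l) r) (Inverse.to (τ l) c) ⟩
    C l r c
      ∎)
    where open ≡-Reasoning

  isEmbeddingFamily : EmbeddingFamily t n (λ _ → d) C
  isEmbeddingFamily = t-mono , n-mono , (λ _ → ≤-refl)
                    , (λ i → C-isCFF (F i) (σ i) (τ i) (degree-fits i)) , C-embeds

corollary2 : (d k0 q : ℕ) → 1 ≤ d → 1 ≤ k0 → IsPrimePower q → d * k0 < q →
    (T : FieldTower q) →
    Σ ((i : ℕ) → Fin (tSeq d q k0 i) ↔ CRow (FieldTower.F T i) (kSeq d q k0 i) d) λ σ →
    Σ ((i : ℕ) → Fin (nSeq d q k0 i) ↔ CCol (FieldTower.F T i) (kSeq d q k0 i)) λ τ →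
      EmbeddingFamily (tSeq d q k0) (nSeq d q k0) (λ _ → d)
        (λ i → Cperm (FieldTower.F T i) (kSeq d q k0 i) d
                 (tSeq d q k0 i) (nSeq d q k0 i) (σ i) (τ i))
      × Σ ℕ λ C → (i : ℕ) → ⌊log₂ nSeq d q k0 i ⌋ ≤ C * tSeq d q k0 i
corollary2 zero    _        _ () _  _ _     _
corollary2 (suc _) zero     _ _  () _ _     _
corollary2 (suc d′) (suc k0′) q _ _ _ dk0<q T = σ , τ , isEmbeddingFamily , q , log-bound
  where open Construction d′ (suc k0′) q (≤-<-trans (s≤s z≤n) dk0<q) dk0<q T
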